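{- Suppose we are given infinite words $\alpha\in\Sigma_1^\omega$, $\beta\in\Sigma_2^\omega$, a deterministic finite Muller automaton $\mathcal{A}$ over $\Sigma_1$, and an oracle that, given a morphism $h\colon\Sigma_1^*\to M$ into a finite monoid $M$, computes a transducer $\mathcal{T}$ with input alphabet $\Sigma_2$ and output alphabet $M$ with the following property: there exists a factorisation $\alpha=w_0w_1w_2\cdots$ into finite words $w_n$ such that $\mathcal{T}(\beta)=h(w_0)h(w_1)h(w_2)\cdots$. Then we can compute a deterministic finite Muller automaton $\mathcal{B}$ over $\Sigma_2$ such that $\alpha\in L(\mathcal{A})\Leftrightarrow\beta\in L(\mathcal{B})$.
   Context: A deterministic finite Muller automaton over $\Sigma$ is $(Q,q_{\mathrm{init}},\delta,\mathcal{F})$ with finite $Q$, $\delta\colon Q\times\Sigma\to Q$, $\mathcal{F}\subseteq 2^Q$; it accepts $\alpha\in\Sigma^\omega$ iff the set of states occurring infinitely often in its run on $\alpha$ belongs to $\mathcal{F}$; $L(\mathcal{A})$ is its set of accepted words. A (deterministic finite) transducer with input alphabet $\Sigma$ and output alphabet $\Gamma$ is $(R,r_{\mathrm{init}},\sigma)$ with finite $R$ and $\sigma\colon R\times\Sigma\to R\times\Gamma^*$; on input $\beta\in\Sigma^\omega$ it reads letters one by one, changing state and emitting a finite word at each step, and $\mathcal{T}(\beta)$ is the concatenation of the emitted words. Words are given by oracles computing $\alpha(n)$ from $n$. -}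

module Defs where

open import Data.Nat using (ℕ; zero; suc; _≤_; _<_; _∸_)
open import Data.Fin using (Fin; fromℕ<)
open import Data.Fin.Subset using (Subset; _∈_)
open import Data.List using (List; []; _∷_; _++_; length; lookup)
open import Data.Product using (Σ; ∃; ∃-syntax; _×_; _,_; proj₁; proj₂)
open import Data.Bool using (Bool; true)
open import Relation.Binary.PropositionalEquality using (_≡_)

Word : ℕ → Set
Word k = ℕ → Fin k

record Muller (k : ℕ) : Set where
  field
    states : ℕ
    init   : Fin states
    δ      : Fin states → Fin k → Fin states
    𝓕      : Subset states → Bool

run : ∀ {k} (A : Muller k) → Word k → ℕ → Fin (Muller.states A)
run A α zero    = Muller.init A
run A α (suc i) = Muller.δ A (run A α i) (α i)

InfOften : ∀ {n} → (ℕ → Fin n) → Fin n → Set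
InfOften r q = ∀ m → ∃[ j ] (m ≤ j × r j ≡ q)

Accepts : ∀ {k} (A : Muller k) → Word k → Set
Accepts A α =
  ∃[ S ] (Muller.𝓕 A S ≡ true ×
          (∀ q → (q ∈ S → InfOften (run A α) q) × (InfOften (run A α) q → q ∈ S)))

record FinMonoid (m : ℕ) : Set where
  field
    _·_       : Fin m → Fin m → Fin m
    e         : Fin m
    assoc     : ∀ x y z → ((x · y) · z) ≡ (x · (y · z))
    identityˡ : ∀ x → (e · x) ≡ x
    identityʳ : ∀ x → (x · e) ≡ x

record Morphism (k : ℕ) {m : ℕ} (M : FinMonoid m) : Set where
  open FinMonoid M
  field
    h     : List (Fin k) → Fin m
    h-[]  : h [] ≡ e
    h-++  : ∀ u v → h (u ++ v) ≡ (h u · h v)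

record Transducer (k m : ℕ) : Set where
  field
    rstates : ℕ
    rinit   : Fin rstates
    σ       : Fin rstates → Fin k → Fin rstates × List (Fin m)

tstate : ∀ {k m} (T : Transducer k m) → Word k → ℕ → Fin (Transducer.rstates T)
tstate T β zero    = Transducer.rinit T
tstate T β (suc i) = proj₁ (Transducer.σ T (tstate T β i) (β i))

emitted : ∀ {k m} (T : Transducer k m) → Word k → ℕ → List (Fin m)
emitted T β zero    = []
emitted T β (suc i) = emitted T β i ++ proj₂ (Transducer.σ T (tstate T β i) (β i))

OutputIs : ∀ {k m} (T : Transducer k m) → Word k → (ℕ → Fin m) → Set
OutputIs T β γ =
  (∀ K i (p : i < length (emitted T β K)) → lookup (emitted T β K) (fromℕ< p) ≡ γ i)
  × (∀ N → ∃[ K ] (N < length (emitted T β K)))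

-- Factorisations α = w₀ w₁ w₂ ⋯ into finite (possibly empty) words,
-- given by cut points 0 = p 0 ≤ p 1 ≤ ⋯ unbounded; w n = α[p n , p (n+1))

slice : ∀ {k} → Word k → ℕ → ℕ → List (Fin k)
slice α i zero    = []
slice α i (suc l) = α i ∷ slice α (suc i) l

record Factorisation {k} (α : Word k) : Set where
  field
    cut       : ℕ → ℕ
    cut-0     : cut zero ≡ zero
    cut-mono  : ∀ n → cut n ≤ cut (suc n)
    cut-unbdd : ∀ N → ∃[ n ] (N ≤ cut n)

  w : ℕ → List (Fin k)
  w n = slice α (cut n) (cut (suc n) ∸ cut n)

Oracle : ℕ → ℕ → Set
Oracle k₁ k₂ = (m : ℕ) (M : FinMonoid m) → Morphism k₁ M → Transducer k₂ m

GoodOracle : ∀ {k₁ k₂} → Word k₁ → Word k₂ → Oracle k₁ k₂ → Set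
GoodOracle {k₁} α β O =
  ∀ (m : ℕ) (M : FinMonoid m) (φ : Morphism k₁ M) →
    ∃[ F ] OutputIs (O m M φ) β (λ n → Morphism.h φ (Factorisation.w {α = α} F n))

{-# OPTIONS --safe #-}

-- The profile of a word w maps each state q of A to the state reached from q on w and the set
-- of states visited on the way; profiles form a finite monoid M. Given the transducer T for
-- w ↦ profile of w, the automaton 𝓑 runs T on β and applies each emitted profile to the current
-- state of A. Since T(β) = h(w₀)h(w₁)⋯, after each step of 𝓑 this is A's state on α at a cut
-- point, and 𝓑 also stores the set of states A visited since the previous such point. The cut
-- points are unbounded, so by the pigeonhole principle a state of A occurs infinitely often iff
-- it lies in the stored set of some state of 𝓑 occurring infinitely often; hence 𝓑 accepts with
-- the table S ↦ 𝓕 (union of the sets stored in S). Excluded middle is needed only to prove this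
-- correct (to obtain the sets of states occurring infinitely often), not to build 𝓑.

module Submission where

open import Defs
open import Data.Nat using (ℕ)
open import Data.Product using (Σ-syntax)
open import Function.Bundles using (_⇔_)
open import Level using (0ℓ)
open import Axiom.ExcludedMiddle using (ExcludedMiddle)

open import Algebra.Core using (Op₂)
open import Algebra.Structures using (IsMonoid)
open import Axiom.DoubleNegationElimination using (em⇒dne)
open import Data.Bool using (Bool; true)
open import Data.Empty using (⊥-elim)
open import Data.Fin using (Fin; zero; suc; fromℕ<)
open import Data.Fin.Properties using (2↔Bool; *↔×; any?)
open import Data.Fin.Subset using (Subset; _∈_; ⊥; ⁅_⁆)
open import Data.Fin.Subset.Properties using (_∈?_; ∉⊥; x∈⁅x⁆; x∈⁅y⁆⇒x≡y; ∪⇔⊎; ∪-isMonoid; ⊆-antisym)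
open import Data.List as List using (List; []; _∷_; _++_; length; foldr; foldl)
open import Data.List.Properties using (length-++)
open import Data.Nat using (zero; suc; _≤_; _<_; _≤′_; _^_; _*_; _+_; _∸_; _⊔_; z≤n; s≤s; ≤′-refl; ≤′-step; _<?_; _≤?_)
open import Data.Nat.Properties using (≤-refl; ≤-trans; ≤-antisym; ≤-pred; <⇒≤; <⇒≱; ≮⇒≥; ≰⇒>; ≤⇒≤′; <-≤-trans; n≤1+n; n<1+n; m≤n⇒m≤1+n; m≤m⊔n; m≤n⊔m; m≤m+n; +-identityʳ; +-suc; m+[n∸m]≡n)
open import Data.Product using (∃; ∃-syntax; _×_; _,_; proj₁; proj₂)
open import Data.Product.Function.NonDependent.Propositional using (_×-↔_)
open import Data.Sum using (_⊎_; inj₁; inj₂)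
open import Data.Sum.Function.Propositional using (_⊎-⇔_)
open import Data.Unit using (⊤; tt)
open import Data.Vec using (Vec; []; _∷_; lookup; tabulate; map)
open import Data.Vec.Properties using (lookup∘tabulate; tabulate∘lookup; tabulate-cong; tabulate-∘; lookup-map; map-∘; map-cong; map-id; []=↔lookup)
open import Function using (_∘_; _↔_; mk⇔; mk↔ₛ′; Inverse; Equivalence)
open import Function.Properties.Equivalence using () renaming (trans to ⇔-trans; sym to ⇔-sym)
open import Function.Properties.Inverse using (↔-refl; ↔-sym; ↔-trans; ↔⇒⇔)
open import Relation.Binary.PropositionalEquality using (_≡_; _≢_; refl; sym; trans; cong; cong₂; subst; subst₂; isEquivalence; module ≡-Reasoning)
open import Relation.Nullary using (¬_; Dec; yes; no; does; contradiction)
open import Relation.Nullary.Decidable using (_×-dec_)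
open import Relation.Unary using (Pred; Decidable)

private
  variable
    A B : Set
    k m n N : ℕ

×↔Fin* : A ↔ Fin m → B ↔ Fin n → (A × B) ↔ Fin (m * n)
×↔Fin* A↔ B↔ = ↔-trans (A↔ ×-↔ B↔) (↔-sym *↔×)

Vec↔Fin^ : A ↔ Fin m → Vec A n ↔ Fin (m ^ n)
Vec↔Fin^ {n = zero}  _  = mk↔ₛ′ (λ _ → zero) (λ _ → []) (λ { zero → refl }) (λ { [] → refl })
Vec↔Fin^ {n = suc n} A↔ = ↔-trans Vec↔× (×↔Fin* A↔ (Vec↔Fin^ A↔))
  where
  Vec↔× : Vec A (suc n) ↔ (A × Vec A n)
  Vec↔× = mk↔ₛ′ (λ { (x ∷ xs) → x , xs }) (λ (x , xs) → x ∷ xs) (λ _ → refl) (λ { (x ∷ xs) → refl })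

Subset↔Fin : Subset n ↔ Fin (2 ^ n)
Subset↔Fin = Vec↔Fin^ (↔-sym 2↔Bool)

toSubset : {P : Pred (Fin n) 0ℓ} → Decidable P → Subset n
toSubset P? = tabulate (does ∘ P?)

∈-toSubset : {P : Pred (Fin n) 0ℓ} (P? : Decidable P) {x : Fin n} → x ∈ toSubset P? ⇔ P x
∈-toSubset P? {x} = ⇔-trans (↔⇒⇔ []=↔lookup)
  (subst (λ b → (b ≡ true) ⇔ _) (sym (lookup∘tabulate _ x)) (does≡true⇔ (P? x)))
  where
  does≡true⇔ : (a? : Dec A) → (does a? ≡ true) ⇔ A
  does≡true⇔ (yes a) = mk⇔ (λ _ → a) (λ _ → refl)
  does≡true⇔ (no ¬a) = mk⇔ (λ ()) (λ a → contradiction a ¬a)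

∈-⋃? : (U : Fin N → Subset n) (S : Subset N) → Decidable (λ x → ∃[ s ] (s ∈ S × x ∈ U s))
∈-⋃? U S x = any? λ s → s ∈? S ×-dec x ∈? U s

⋃[_] : (Fin N → Subset n) → Subset N → Subset n
⋃[ U ] S = toSubset (∈-⋃? U S)

∈-⋃ : {U : Fin N → Subset n} {S : Subset N} {x : Fin n} →
      x ∈ ⋃[ U ] S ⇔ (∃[ s ] (s ∈ S × x ∈ U s))
∈-⋃ {U = U} {S} = ∈-toSubset (∈-⋃? U S)

module _ {X : Set} {_∙_ : Op₂ X} {ε : X} (isMonoid : IsMonoid _≡_ _∙_ ε) where
  open IsMonoid isMonoid using (assoc; identityˡ; identityʳ)

  extend : (A → X) → List A → X
  extend f = foldr (λ a x → f a ∙ x) ε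

  extend-++ : (f : A → X) (u v : List A) → extend f (u ++ v) ≡ extend f u ∙ extend f v
  extend-++ f []      v = sym (identityˡ _)
  extend-++ f (a ∷ u) v = trans (cong (f a ∙_) (extend-++ f u v)) (sym (assoc _ _ _))

  module _ (X↔ : X ↔ Fin m) where
    open Inverse X↔ using (to; from; strictlyInverseˡ; strictlyInverseʳ)

    transportMonoid : FinMonoid m
    transportMonoid = record
      { _·_       = λ a b → to (from a ∙ from b)
      ; e         = to ε
      ; assoc     = λ a b c → cong to (begin
          from (to (from a ∙ from b)) ∙ from c  ≡⟨ cong (_∙ from c) (strictlyInverseʳ _) ⟩
          (from a ∙ from b) ∙ from c            ≡⟨ assoc _ _ _ ⟩
          from a ∙ (from b ∙ from c)            ≡⟨ cong (from a ∙_) (strictlyInverseʳ _) ⟨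
          from a ∙ from (to (from b ∙ from c))  ∎)
      ; identityˡ = λ a → trans (cong (λ x → to (x ∙ from a)) (strictlyInverseʳ ε))
                                (trans (cong to (identityˡ _)) (strictlyInverseˡ a))
      ; identityʳ = λ a → trans (cong (λ x → to (from a ∙ x)) (strictlyInverseʳ ε))
                                (trans (cong to (identityʳ _)) (strictlyInverseˡ a))
      }
      where open ≡-Reasoning

    transportExtend : (Fin k → X) → Morphism k transportMonoid
    transportExtend f = record
      { h    = to ∘ extend f
      ; h-[] = refl
      ; h-++ = λ u v → cong to (trans (extend-++ f u v)
                                 (sym (cong₂ _∙_ (strictlyInverseʳ _) (strictlyInverseʳ _))))
      }

-- The wreath product of the full transformation monoid of Fin Q with S: a profile sends each
-- start state to an end state and a label.
module Profiles {S : Set} {_∙_ : Op₂ S} {ε : S} (S-isMonoid : IsMonoid _≡_ _∙_ ε) (Q : ℕ) where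
  open IsMonoid S-isMonoid using ()
    renaming (assoc to ∙-assoc; identityˡ to ∙-identityˡ; identityʳ to ∙-identityʳ)

  Profile : Set
  Profile = Vec (Fin Q × S) Q

  infixl 5 _◃_
  _◃_ : Fin Q × S → Profile → Fin Q × S
  (q , s) ◃ x = proj₁ (lookup x q) , s ∙ proj₂ (lookup x q)

  _⊙_ : Op₂ Profile
  x ⊙ y = map (_◃ y) x

  ι : Profile
  ι = tabulate (_, ε)

  ◃-⊙ : ∀ p x y → p ◃ x ◃ y ≡ p ◃ (x ⊙ y)
  ◃-⊙ (q , s) x y = trans (cong (_ ,_) (∙-assoc s _ _))
                          (cong (λ p → proj₁ p , s ∙ proj₂ p) (sym (lookup-map q (_◃ y) x)))

  ◃-ι : ∀ p → p ◃ ι ≡ p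
  ◃-ι (q , s) = trans (cong (λ p → proj₁ p , s ∙ proj₂ p) (lookup∘tabulate (_, ε) q))
                      (cong (q ,_) (∙-identityʳ s))

  ⊙-isMonoid : IsMonoid _≡_ _⊙_ ι
  ⊙-isMonoid = record
    { isSemigroup = record
      { isMagma = record { isEquivalence = isEquivalence ; ∙-cong = cong₂ _⊙_ }
      ; assoc   = λ x y z → trans (sym (map-∘ _ _ x)) (map-cong (λ p → ◃-⊙ p y z) x)
      }
    ; identity = (λ x → begin
        map (_◃ x) (tabulate (_, ε))  ≡⟨ tabulate-∘ _ _ ⟨
        tabulate (λ q → (q , ε) ◃ x)  ≡⟨ tabulate-cong (λ q → cong (_ ,_) (∙-identityˡ _)) ⟩
        tabulate (lookup x)           ≡⟨ tabulate∘lookup x ⟩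
        x                             ∎)
      , λ x → trans (map-cong ◃-ι x) (map-id x)
    }
    where open ≡-Reasoning

monotone : {f : ℕ → ℕ} → (∀ n → f n ≤ f (suc n)) → m ≤ n → f m ≤ f n
monotone {f = f} step = go ∘ ≤⇒≤′
  where
  go : m ≤′ n → f m ≤ f n
  go ≤′-refl       = ≤-refl
  go (≤′-step m≤n) = ≤-trans (go m≤n) (step _)

bracket : {f : ℕ → ℕ} → (∀ n → f n ≤ f (suc n)) →
          ∀ {m j} K → f m ≤ j → j < f K → ∃[ L ] (m ≤ L × f L ≤ j × j < f (suc L))
bracket step zero fm≤j j<f0 = ⊥-elim (<⇒≱ j<f0 (≤-trans (monotone step z≤n) fm≤j))
bracket {f = f} step {m} {j} (suc K) fm≤j j<fK+1 with j <? f K | m ≤? K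
... | yes j<fK | _       = bracket step K fm≤j j<fK
... | no j≮fK  | yes m≤K = K , m≤K , ≮⇒≥ j≮fK , j<fK+1
... | no _     | no m≰K  = ⊥-elim (<⇒≱ j<fK+1 (≤-trans (monotone step (≰⇒> m≰K)) fm≤j))

Visits : (ℕ → A) → ℕ → ℕ → A → Set
Visits r a b x = ∃[ j ] (a ≤ j × j < b × r j ≡ x)

visits-split : {r : ℕ → A} {a b c : ℕ} {x : A} → a ≤ b → b ≤ c →
               Visits r a c x ⇔ (Visits r a b x ⊎ Visits r b c x)
visits-split {r = r} {a} {b} {c} {x} a≤b b≤c = mk⇔ split join
  where
  split : Visits r a c x → Visits r a b x ⊎ Visits r b c x
  split (j , a≤j , j<c , eq) with j <? b
  ... | yes j<b = inj₁ (j , a≤j , j<b , eq)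
  ... | no j≮b  = inj₂ (j , ≮⇒≥ j≮b , j<c , eq)

  join : Visits r a b x ⊎ Visits r b c x → Visits r a c x
  join (inj₁ (j , a≤j , j<b , eq)) = j , a≤j , <-≤-trans j<b b≤c , eq
  join (inj₂ (j , b≤j , j<c , eq)) = j , ≤-trans a≤b b≤j , j<c , eq

Eventually : (ℕ → Set) → Set
Eventually P = ∃[ m ] (∀ j → m ≤ j → P j)

eventually-∀ : {P : Fin n → ℕ → Set} → (∀ s → Eventually (P s)) → Eventually (λ j → ∀ s → P s j)
eventually-∀ {n = zero}  _  = 0 , λ _ _ ()
eventually-∀ {n = suc n} ev with ev zero | eventually-∀ (ev ∘ suc)
... | m₀ , f₀ | m , f = m₀ ⊔ m , λ where
  j le zero    → f₀ j (≤-trans (m≤m⊔n m₀ m) le)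
  j le (suc s) → f j (≤-trans (m≤n⊔m m₀ m) le) s

module _ (em : ExcludedMiddle 0ℓ) (ρ : ℕ → Fin n) where

  ¬infOften⇒eventually≢ : ∀ {s} → ¬ InfOften ρ s → Eventually (λ j → ρ j ≢ s)
  ¬infOften⇒eventually≢ ¬inf =
    em⇒dne em λ ¬ev → ¬inf λ m → em⇒dne em λ ¬hit → ¬ev (m , λ j m≤j eq → ¬hit (j , m≤j , eq))

  infOften-pigeonhole : (P : Fin n → Set) → (∀ m → ∃[ j ] (m ≤ j × P (ρ j))) →
                        ∃[ s ] (P s × InfOften ρ s)
  infOften-pigeonhole P often = em⇒dne em λ ¬goal →
    let (m , avoids)    = eventually-∀ (avoid ¬goal)
        (j , m≤j , Pρj) = often m
    in avoids j m≤j (ρ j) refl Pρj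
    where
    avoid : ¬ (∃[ s ] (P s × InfOften ρ s)) → ∀ s → Eventually (λ j → ρ j ≡ s → ¬ P s)
    avoid ¬goal s with em {P s}
    ... | no ¬Ps = 0 , λ _ _ _ → ¬Ps
    ... | yes Ps = let (m , f) = ¬infOften⇒eventually≢ λ inf → ¬goal (s , Ps , inf)
                   in m , λ j m≤j eq _ → f j m≤j eq

module Blocks {r : ℕ → Fin n} {ρ : ℕ → Fin N} (U : Fin N → Subset n) {g : ℕ → ℕ}
              (g-step : ∀ K → g K ≤ g (suc K)) (g-unbounded : ∀ j → ∃[ K ] (j < g K))
              (block : ∀ K {q} → q ∈ U (ρ (suc K)) ⇔ Visits r (g K) (g (suc K)) q) where

  infOften⇐ : ∀ {q s} → q ∈ U s → InfOften ρ s → InfOften r q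
  infOften⇐ q∈Us s-inf m with g-unbounded m
  ... | K , m<gK with s-inf (suc K)
  ... | suc L , K<L+1 , refl =
    let (j , gL≤j , _ , eq) = Equivalence.to (block L) q∈Us
    in j , ≤-trans (<⇒≤ m<gK) (≤-trans (monotone g-step (≤-pred K<L+1)) gL≤j) , eq

  infOften⇒ : ExcludedMiddle 0ℓ → ∀ {q} → InfOften r q → ∃[ s ] (q ∈ U s × InfOften ρ s)
  infOften⇒ em {q} q-inf = infOften-pigeonhole em ρ (λ s → q ∈ U s) λ m →
    let (j , gm≤j , eq)            = q-inf (g m)
        (K′ , j<gK′)               = g-unbounded j
        (K , m≤K , gK≤j , j<gK+1) = bracket g-step K′ gm≤j j<gK′
    in suc K , m≤n⇒m≤1+n m≤K , Equivalence.from (block K) (j , gK≤j , j<gK+1 , eq)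

  infOften⇔ : ExcludedMiddle 0ℓ → ∀ q → InfOften r q ⇔ (∃[ s ] (q ∈ U s × InfOften ρ s))
  infOften⇔ em q = mk⇔ (infOften⇒ em) λ (s , q∈Us , s-inf) → infOften⇐ q∈Us s-inf

InfSet : (ℕ → Fin n) → Subset n → Set
InfSet r S = ∀ q → (q ∈ S → InfOften r q) × (InfOften r q → q ∈ S)

-- Accepts A α unfolds to MullerAccepts (Muller.𝓕 A) (run A α).
MullerAccepts : (Subset n → Bool) → (ℕ → Fin n) → Set
MullerAccepts 𝓕 r = ∃[ S ] (𝓕 S ≡ true × InfSet r S)

infSet-unique : {r : ℕ → Fin n} {S S′ : Subset n} → InfSet r S → InfSet r S′ → S ≡ S′
infSet-unique S-inf S′-inf = ⊆-antisym
  (λ {q} q∈S  → proj₂ (S′-inf q) (proj₁ (S-inf q) q∈S))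
  (λ {q} q∈S′ → proj₂ (S-inf q) (proj₁ (S′-inf q) q∈S′))

infSet-exists : ExcludedMiddle 0ℓ → (r : ℕ → Fin n) → ∃ (InfSet r)
infSet-exists em r = toSubset (λ _ → em) , λ q →
  Equivalence.to (∈-toSubset {P = InfOften r} (λ _ → em)) , Equivalence.from (∈-toSubset (λ _ → em))

module _ {r : ℕ → Fin n} {ρ : ℕ → Fin N} {U : Fin N → Subset n}
         (infOften⇔ : ∀ q → InfOften r q ⇔ (∃[ s ] (q ∈ U s × InfOften ρ s))) where

  infSet-⋃ : ∀ {S} → InfSet ρ S → InfSet r (⋃[ U ] S)
  infSet-⋃ S-inf q =
      (λ q∈⋃ → let (s , s∈S , q∈Us) = Equivalence.to ∈-⋃ q∈⋃
               in Equivalence.from (infOften⇔ q) (s , q∈Us , proj₁ (S-inf s) s∈S))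
    , (λ q-inf → let (s , q∈Us , s-inf) = Equivalence.to (infOften⇔ q) q-inf
                 in Equivalence.from ∈-⋃ (s , proj₂ (S-inf s) s-inf , q∈Us))

  mullerAccepts-⋃ : ExcludedMiddle 0ℓ → (𝓕 : Subset n → Bool) →
                    MullerAccepts 𝓕 r ⇔ MullerAccepts (𝓕 ∘ ⋃[ U ]) ρ
  mullerAccepts-⋃ em 𝓕 = mk⇔
    (λ (S , 𝓕S , S-inf) → let (S′ , S′-inf) = infSet-exists em ρ
                          in S′ , trans (cong 𝓕 (infSet-unique (infSet-⋃ S′-inf) S-inf)) 𝓕S , S′-inf)
    (λ (S′ , 𝓕S′ , S′-inf) → ⋃[ U ] S′ , 𝓕S′ , infSet-⋃ S′-inf)

trace : {S : Set} → S → (S → Fin k → S) → Word k → ℕ → S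
trace s₀ step β zero    = s₀
trace s₀ step β (suc i) = step (trace s₀ step β i) (β i)

module _ {S : Set} (S↔ : S ↔ Fin n) where
  open Inverse S↔ using (to; from; strictlyInverseʳ)

  encodeMuller : S → (S → Fin k → S) → (Subset n → Bool) → Muller k
  encodeMuller s₀ step 𝓕 = record
    { states = n ; init = to s₀ ; δ = λ q a → to (step (from q) a) ; 𝓕 = 𝓕 }

  from-run : ∀ {s₀ : S} {step : S → Fin k → S} {𝓕} (β : Word k) i →
             from (run (encodeMuller s₀ step 𝓕) β i) ≡ trace s₀ step β i
  from-run β zero    = strictlyInverseʳ _
  from-run {step = step} β (suc i) =
    trans (strictlyInverseʳ _) (cong (λ s → step s (β i)) (from-run β i))

Segment : (ℕ → A) → ℕ → List A → Set
Segment γ n []       = ⊤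
Segment γ n (x ∷ xs) = x ≡ γ n × Segment γ (suc n) xs

segment-lookup : {γ : ℕ → A} (xs : List A) →
                 (∀ i (i<∣xs∣ : i < length xs) → List.lookup xs (fromℕ< i<∣xs∣) ≡ γ (n + i)) →
                 Segment γ n xs
segment-lookup                 []       _   = tt
segment-lookup {n = n} {γ = γ} (x ∷ xs) xs≡ =
    trans (xs≡ 0 (s≤s z≤n)) (cong γ (+-identityʳ n))
  , segment-lookup xs λ i i<∣xs∣ → trans (xs≡ (suc i) (s≤s i<∣xs∣)) (cong γ (+-suc n i))

segment-++ʳ : {γ : ℕ → A} (xs : List A) {ys : List A} →
              Segment γ n (xs ++ ys) → Segment γ (n + length xs) ys
segment-++ʳ {n = n} {γ = γ} []       {ys} seg       =
  subst (λ m → Segment γ m ys) (sym (+-identityʳ n)) seg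
segment-++ʳ {n = n} {γ = γ} (x ∷ xs) {ys} (_ , seg) =
  subst (λ m → Segment γ m ys) (sym (+-suc n (length xs))) (segment-++ʳ xs seg)

module MullerProfiles (A : Muller k) where
  open Muller A using (states; δ)
  open Profiles (∪-isMonoid states) states public

  letter : Fin k → Profile
  letter a = tabulate λ q → δ q a , ⁅ q ⁆

  readWord : List (Fin k) → Profile
  readWord = extend ⊙-isMonoid letter

  module Along (α : Word k) where

    r : ℕ → Fin states
    r = run A α

    Summarises : Fin states × Subset states → ℕ → ℕ → Set
    Summarises (q , V) a b = q ≡ r b × (∀ {x} → x ∈ V ⇔ Visits r a b x)

    summarises-empty : ∀ a → Summarises (r a , ⊥) a a
    summarises-empty a = refl , mk⇔
      (λ x∈⊥ → contradiction x∈⊥ ∉⊥)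
      (λ (j , a≤j , j<a , _) → contradiction a≤j (<⇒≱ j<a))

    summarises-letter : ∀ i → Summarises (lookup (letter (α i)) (r i)) i (suc i)
    summarises-letter i =
      subst (λ p → Summarises p i (suc i)) (sym (lookup∘tabulate _ (r i))) (refl , mk⇔
      (λ x∈ → i , ≤-refl , n<1+n i , sym (x∈⁅y⁆⇒x≡y _ x∈))
      (λ (j , i≤j , j<1+i , rj≡x) →
         subst (_∈ ⁅ r i ⁆) (trans (cong r (≤-antisym i≤j (≤-pred j<1+i))) rj≡x) (x∈⁅x⁆ (r i))))

    summarises-◃ : ∀ {p a b c} x → a ≤ b → b ≤ c → Summarises p a b →
                   Summarises (lookup x (r b)) b c → Summarises (p ◃ x) a c
    summarises-◃ x a≤b b≤c (refl , V⇔) (end , V′⇔) =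
      end , ⇔-trans ∪⇔⊎ (⇔-trans (V⇔ ⊎-⇔ V′⇔) (⇔-sym (visits-split a≤b b≤c)))

    summarises-slice : ∀ l {p a i} → a ≤ i → Summarises p a i →
                       Summarises (p ◃ readWord (slice α i l)) a (i + l)
    summarises-slice zero    {p} {a} {i} _   sum =
      subst₂ (λ p b → Summarises p a b) (sym (◃-ι p)) (sym (+-identityʳ i)) sum
    summarises-slice (suc l) {p} {a} {i} a≤i sum =
      subst₂ (λ p b → Summarises p a b)
        (◃-⊙ p (letter (α i)) (readWord (slice α (suc i) l))) (sym (+-suc i l))
        (summarises-slice l (≤-trans a≤i (n≤1+n i))
          (summarises-◃ (letter (α i)) a≤i (n≤1+n i) sum (summarises-letter i)))

module Construction {k₁ k₂ : ℕ} (A : Muller k₁) (O : Oracle k₁ k₂) where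
  open Muller A using (states; init; 𝓕)
  open MullerProfiles A

  Label : Set
  Label = Fin states × Subset states

  Label↔ : Label ↔ Fin (states * 2 ^ states)
  Label↔ = ×↔Fin* ↔-refl Subset↔Fin

  Profile↔ : Profile ↔ Fin ((states * 2 ^ states) ^ states)
  Profile↔ = Vec↔Fin^ Label↔

  open Inverse Profile↔ using (from; strictlyInverseʳ)

  M : FinMonoid _
  M = transportMonoid ⊙-isMonoid Profile↔

  φ : Morphism k₁ M
  φ = transportExtend ⊙-isMonoid Profile↔ letter

  T : Transducer k₂ _
  T = O _ M φ

  open Transducer T using (rstates; rinit; σ)

  feed : Label → List (Fin _) → Label
  feed = foldl λ p c → p ◃ from c

  State : Set
  State = Fin rstates × Label

  State↔ : State ↔ Fin (rstates * (states * 2 ^ states))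
  State↔ = ×↔Fin* ↔-refl Label↔

  step : State → Fin k₂ → State
  step (t , q , _) b = proj₁ (σ t b) , feed (q , ⊥) (proj₂ (σ t b))

  visited : Fin (rstates * (states * 2 ^ states)) → Subset states
  visited = proj₂ ∘ proj₂ ∘ Inverse.from State↔

  𝓑 : Muller k₂
  𝓑 = encodeMuller State↔ (rinit , init , ⊥) step (𝓕 ∘ ⋃[ visited ])

  module Correctness {α : Word k₁} {β : Word k₂} (F : Factorisation α)
                     (out : OutputIs T β (λ n → Morphism.h φ (Factorisation.w F n))) where
    open Factorisation F
    open Along α

    γ : ℕ → Fin _
    γ n = Morphism.h φ (w n)

    -- After K letters of β the transducer has emitted h (w 0) ⋯ h (w (L - 1)),
    -- L = length (emitted T β K), which is the image of α up to position g K.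
    g : ℕ → ℕ
    g K = cut (length (emitted T β K))

    chunk : ℕ → List (Fin _)
    chunk K = proj₂ (σ (tstate T β K) (β K))

    g-step : ∀ K → g K ≤ g (suc K)
    g-step K = monotone cut-mono
      (subst (length (emitted T β K) ≤_) (sym (length-++ (emitted T β K))) (m≤m+n _ _))

    g-unbounded : ∀ j → ∃[ K ] (j < g K)
    g-unbounded j =
      let (n , j<cut) = cut-unbdd (suc j)
          (K , n<∣out∣) = proj₂ out n
      in K , ≤-trans j<cut (monotone cut-mono (<⇒≤ n<∣out∣))

    chunk-segment : ∀ K → Segment γ (length (emitted T β K)) (chunk K)
    chunk-segment K =
      segment-++ʳ (emitted T β K) (segment-lookup (emitted T β (suc K)) (proj₁ out (suc K)))

    summarises-feed : ∀ xs {n p a} → a ≤ cut n → Summarises p a (cut n) → Segment γ n xs →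
                      Summarises (feed p xs) a (cut (n + length xs))
    summarises-feed []       {n} {p} {a} _     sum _          =
      subst (Summarises p a ∘ cut) (sym (+-identityʳ n)) sum
    summarises-feed (c ∷ cs) {n} {p} {a} a≤cut sum (refl , seg) =
      subst (Summarises (feed (p ◃ from c) cs) a ∘ cut) (sym (+-suc n (length cs)))
        (summarises-feed cs (≤-trans a≤cut (cut-mono n)) sum′ seg)
      where
      sum′ : Summarises (p ◃ from c) a (cut (suc n))
      sum′ = subst₂ (λ x b → Summarises (p ◃ x) a b)
               (sym (strictlyInverseʳ (readWord (w n)))) (m+[n∸m]≡n (cut-mono n))
               (summarises-slice (cut (suc n) ∸ cut n) a≤cut sum)

    stateAt : ℕ → State
    stateAt = trace (rinit , init , ⊥) step β

    stateAt-transducer : ∀ K → proj₁ (stateAt K) ≡ tstate T β K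
    stateAt-transducer zero    = refl
    stateAt-transducer (suc K) = cong (λ t → proj₁ (σ t (β K))) (stateAt-transducer K)

    stateAt-A : ∀ K → proj₁ (proj₂ (stateAt K)) ≡ r (g K)
    stateAt-summarises : ∀ K → Summarises (proj₂ (stateAt (suc K))) (g K) (g (suc K))

    stateAt-A zero    = cong r (sym cut-0)
    stateAt-A (suc K) = proj₁ (stateAt-summarises K)

    stateAt-summarises K =
      subst₂ (λ t q → Summarises (feed (q , ⊥) (proj₂ (σ t (β K)))) (g K) (g (suc K)))
        (sym (stateAt-transducer K)) (sym (stateAt-A K))
        (subst (Summarises (feed (r (g K) , ⊥) (chunk K)) (g K) ∘ cut)
          (sym (length-++ (emitted T β K)))
          (summarises-feed (chunk K) ≤-refl (summarises-empty (g K)) (chunk-segment K)))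

    block : ∀ K {q} → q ∈ visited (run 𝓑 β (suc K)) ⇔ Visits r (g K) (g (suc K)) q
    block K {q} = subst (λ x → q ∈ proj₂ (proj₂ x) ⇔ Visits r (g K) (g (suc K)) q)
                    (sym (from-run State↔ {step = step} {𝓕 ∘ ⋃[ visited ]} β (suc K)))
                    (proj₂ (stateAt-summarises K))

    accepts⇔ : ExcludedMiddle 0ℓ → Accepts A α ⇔ Accepts 𝓑 β
    accepts⇔ em = mullerAccepts-⋃ (Blocks.infOften⇔ visited g-step g-unbounded block em) em 𝓕

theorem3p8 : Σ[ f ∈ ((k₁ k₂ : ℕ) → Word k₁ → Word k₂ → Muller k₁ → Oracle k₁ k₂ → Muller k₂) ]
                 (ExcludedMiddle 0ℓ →
                  (k₁ k₂ : ℕ) (α : Word k₁) (β : Word k₂) (A : Muller k₁) (O : Oracle k₁ k₂) →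
                  GoodOracle α β O →
                  (Accepts A α ⇔ Accepts (f k₁ k₂ α β A O) β))
theorem3p8 = (λ _ _ _ _ → Construction.𝓑) , λ em _ _ α β A O good →
  let open Construction A O
      (F , out) = good _ M φ
  in Correctness.accepts⇔ F out em
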